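{- Let ${\cal A}\subset\mathbb{Z}^2$ be an anticode of diameter $d\ge2$ in the grid graph ${\cal G}_2$. Then the set of internal points of ${\cal A}$, if nonempty, is an anticode of diameter $d-2$.
   Context: The grid graph ${\cal G}_2$ has vertex set $\mathbb{Z}^2$, with $z,z'$ adjacent iff their $L_1$-distance $d(z,z')$ equals $1$. A set ${\cal A}\subset\mathbb{Z}^2$ is an anticode of diameter $d$ if $d(z_1,z_2)\le d$ for all $z_1,z_2\in{\cal A}$. A point $z\in{\cal A}$ is an internal point of ${\cal A}$ if all four of its neighbors in ${\cal G}_2$ belong to ${\cal A}$. -}

module Defs where

open import Level using (Level; suc)
open import Data.Nat using (ℕ; _+_; _≤_)
open import Data.Integer using (ℤ; ∣_∣; _-_; +_; _+_)
open import Data.Product using (_×_; _,_)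

Point : Set
Point = ℤ × ℤ

-- L1 distance (graph distance in the grid graph G_2)
dist : Point → Point → ℕ
dist (x₁ , y₁) (x₂ , y₂) = ∣ x₁ - x₂ ∣ Data.Nat.+ ∣ y₁ - y₂ ∣

Subset : (ℓ : Level) → Set (Level.suc ℓ)
Subset ℓ = Point → Set ℓ

IsAnticode : {ℓ : Level} → Subset ℓ → ℕ → Set ℓ
IsAnticode A d = ∀ z₁ z₂ → A z₁ → A z₂ → dist z₁ z₂ ≤ d

IsInternal : {ℓ : Level} → Subset ℓ → Point → Set ℓ
IsInternal A (x , y) =
  A (x , y) × A (x Data.Integer.+ + 1 , y) × A (x Data.Integer.- + 1 , y)
            × A (x , y Data.Integer.+ + 1) × A (x , y Data.Integer.- + 1)

Internal : {ℓ : Level} → Subset ℓ → Subset ℓ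
Internal A = IsInternal A

module Submission where

open import Defs
open import Level using (Level)
open import Data.Nat using (ℕ; _≤_; _∸_)
open import Data.Product using (∃; ∃₂; _,_; _×_)

import Data.Nat as ℕ
open import Data.Nat.Properties using (+-suc; +-identityʳ; +-commutativeSemigroup; m+n≤o⇒m≤o∸n)
open import Algebra.Properties.CommutativeSemigroup +-commutativeSemigroup using (xy∙z≈xz∙y)
open import Data.Integer as ℤ using (+_; -[1+_]; ∣_∣)
import Data.Integer.Properties as ℤ
open import Data.Integer.Tactic.RingSolver using (solve-∀)
open import Data.Sum using (_⊎_; inj₁; inj₂) renaming (map to ⊎-map)
open import Relation.Binary.PropositionalEquality

-- Move two internal points z₁, z₂ to horizontal neighbours in opposite directions,
-- away from each other according to the sign of x₁ - x₂. Both neighbours lie in A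
-- and are at distance dist z₁ z₂ + 2, so dist z₁ z₂ + 2 ≤ d.

∣i+n∣≡∣i∣+n⊎∣i-n∣≡∣i∣+n : ∀ i n → ∣ i ℤ.+ + n ∣ ≡ ∣ i ∣ ℕ.+ n ⊎ ∣ i ℤ.- + n ∣ ≡ ∣ i ∣ ℕ.+ n
∣i+n∣≡∣i∣+n⊎∣i-n∣≡∣i∣+n (+ m)    n         = inj₁ refl
∣i+n∣≡∣i∣+n⊎∣i-n∣≡∣i∣+n -[1+ m ] 0         =
  inj₁ (trans (cong ∣_∣ (ℤ.+-identityʳ -[1+ m ])) (sym (+-identityʳ (ℕ.suc m))))
∣i+n∣≡∣i∣+n⊎∣i-n∣≡∣i∣+n -[1+ m ] (ℕ.suc k) = inj₂ (cong ℕ.suc (sym (+-suc m k)))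

[a+1]-[b-1]≡[a-b]+2 : ∀ a b → (a ℤ.+ + 1) ℤ.- (b ℤ.- + 1) ≡ (a ℤ.- b) ℤ.+ + 2
[a+1]-[b-1]≡[a-b]+2 = solve-∀

[a-1]-[b+1]≡[a-b]-2 : ∀ a b → (a ℤ.- + 1) ℤ.- (b ℤ.+ + 1) ≡ (a ℤ.- b) ℤ.- + 2
[a-1]-[b+1]≡[a-b]-2 = solve-∀

dist-moved-apart : ∀ x₁ y₁ x₂ y₂ →
  dist (x₁ ℤ.+ + 1 , y₁) (x₂ ℤ.- + 1 , y₂) ≡ dist (x₁ , y₁) (x₂ , y₂) ℕ.+ 2 ⊎
  dist (x₁ ℤ.- + 1 , y₁) (x₂ ℤ.+ + 1 , y₂) ≡ dist (x₁ , y₁) (x₂ , y₂) ℕ.+ 2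
dist-moved-apart x₁ y₁ x₂ y₂
  rewrite [a+1]-[b-1]≡[a-b]+2 x₁ x₂ | [a-1]-[b+1]≡[a-b]-2 x₁ x₂ =
  ⊎-map add-∣Δy∣ add-∣Δy∣ (∣i+n∣≡∣i∣+n⊎∣i-n∣≡∣i∣+n (x₁ ℤ.- x₂) 2)
  where
  ∣Δy∣ : ℕ
  ∣Δy∣ = ∣ y₁ ℤ.- y₂ ∣
  add-∣Δy∣ : ∀ {m} → m ≡ ∣ x₁ ℤ.- x₂ ∣ ℕ.+ 2 → m ℕ.+ ∣Δy∣ ≡ ∣ x₁ ℤ.- x₂ ∣ ℕ.+ ∣Δy∣ ℕ.+ 2
  add-∣Δy∣ eq = trans (cong (ℕ._+ ∣Δy∣) eq) (xy∙z≈xz∙y ∣ x₁ ℤ.- x₂ ∣ 2 ∣Δy∣)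

internal-points-move-apart : ∀ {ℓ} (A : Subset ℓ) z₁ z₂ → Internal A z₁ → Internal A z₂ →
  ∃₂ λ w₁ w₂ → A w₁ × A w₂ × dist w₁ w₂ ≡ dist z₁ z₂ ℕ.+ 2
internal-points-move-apart A (x₁ , y₁) (x₂ , y₂) (_ , right₁ , left₁ , _) (_ , right₂ , left₂ , _)
  with dist-moved-apart x₁ y₁ x₂ y₂
... | inj₁ eq = _ , _ , right₁ , left₂ , eq
... | inj₂ eq = _ , _ , left₁ , right₂ , eq

lemma5 : {ℓ : Level} (A : Subset ℓ) (d : ℕ) → 2 ≤ d → IsAnticode A d
           → ∃ (λ z → Internal A z) → IsAnticode (Internal A) (d ∸ 2)
lemma5 A d _ anticode _ z₁ z₂ internal₁ internal₂ =
  let w₁ , w₂ , w₁∈A , w₂∈A , dist-w≡dist-z+2 = internal-points-move-apart A z₁ z₂ internal₁ internal₂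
  in m+n≤o⇒m≤o∸n (dist z₁ z₂) (subst (_≤ d) dist-w≡dist-z+2 (anticode w₁ w₂ w₁∈A w₂∈A))
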